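{- Let $\Gamma,\Gamma'$ be simple graphs on a finite set $X$ ($|X|\ge 3$) with matrices $\mathcal{E},\mathcal{E}'$. 1. For all $j,k\in X$, ${}^k\mathcal{E}={}^k({}^j\mathcal{E})$. 2. $\mathcal{E}$ and $\mathcal{E}'$ are associated if and only if there exists $k\in X$ with ${}^k\mathcal{E}={}^k\mathcal{E}'$; in that case ${}^j\mathcal{E}={}^j\mathcal{E}'$ for all $j\in X$. 3. For every permutation $\sigma$ of $X$ the following are equivalent: (a) $\mathcal{E}$ and ${}^\sigma\mathcal{E}$ are associated; (b) for every $j\in X$, ${}^\sigma({}^j\mathcal{E})={}^{\sigma(j)}\mathcal{E}$; (c) there exists $k\in X$ with ${}^\sigma({}^k\mathcal{E})={}^{\sigma(k)}\mathcal{E}$.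
   Context: The matrix of a simple graph on $X$ is $\mathcal{E}=(\varepsilon_{i,j})$ with $\varepsilon_{i,j}=-1$ if $i\neq j$ are adjacent and $1$ otherwise. Matrices $\mathcal{E}=(\varepsilon_{i,j})$, $\mathcal{E}'=(\varepsilon'_{i,j})$ are associated if there exist $\nu_i\in\{ -1,1\}$ with $\varepsilon'_{i,j}=\nu_i\nu_j\varepsilon_{i,j}$ for all $i,j$. For a permutation $\sigma$ of $X$, $({}^\sigma M)_{i,j}=M_{\sigma^{ -1}(i),\sigma^{ -1}(j)}$. For $j\in X$, the localized matrix ${}^j\mathcal{E}$ is the unique matrix associated to $\mathcal{E}$ whose $j$-th column consists only of $1$'s (explicitly $({}^j\mathcal{E})_{k,l}=\nu_k\nu_l\varepsilon_{k,l}$ with $\nu_k=\varepsilon_{k,j}$ for $k\ne j$, $\nu_j=1$). -}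

module Defs where

open import Data.Nat using (ℕ)
open import Data.Bool using (Bool; true; false; not)
open import Data.Fin using (Fin; _≟_)
open import Data.Fin.Permutation using (Permutation′; _⟨$⟩ʳ_; _⟨$⟩ˡ_)
open import Data.Sign using (Sign; _*_) renaming (+ to ⊕; - to ⊖)
open import Data.Product using (∃)
open import Relation.Nullary using (yes; no)
open import Relation.Binary.PropositionalEquality using (_≡_)

record SimpleGraph (n : ℕ) : Set where
  field
    adj   : Fin n → Fin n → Bool
    sym   : ∀ i j → adj i j ≡ adj j i
    irrefl : ∀ i → adj i i ≡ false

open SimpleGraph public

-- ±1 matrices indexed by X, with entries in Sign (⊕ = 1, ⊖ = -1).
SignMatrix : ℕ → Set
SignMatrix n = Fin n → Fin n → Sign

_≋_ : ∀ {n} → SignMatrix n → SignMatrix n → Set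
E ≋ E′ = ∀ i j → E i j ≡ E′ i j

graphMatrix : ∀ {n} → SimpleGraph n → SignMatrix n
graphMatrix Γ i j with i ≟ j
... | yes _ = ⊕
... | no  _ with adj Γ i j
...   | true  = ⊖
...   | false = ⊕

Associated : ∀ {n} → SignMatrix n → SignMatrix n → Set
Associated {n} E E′ = ∃ λ (ν : Fin n → Sign) → ∀ i j → E′ i j ≡ (ν i * ν j) * E i j

permAct : ∀ {n} → Permutation′ n → SignMatrix n → SignMatrix n
permAct σ M i j = M (σ ⟨$⟩ˡ i) (σ ⟨$⟩ˡ j)

locSign : ∀ {n} → SignMatrix n → Fin n → Fin n → Sign
locSign E j k with k ≟ j
... | yes _ = ⊕
... | no  _ = E k j

localize : ∀ {n} → Fin n → SignMatrix n → SignMatrix n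
localize j E k l = (locSign E j k * locSign E j l) * E k l

-- The localization ᵏE is the unique matrix associated to E whose k-th column
-- consists of 1's: if F ~ G via ν and both have unit k-th column, then
-- ν_a ν_k = 1, so ν is constant and F = G. Hence associated matrices have the
-- same localizations, and conversely E ~ ᵏE = ᵏE′ ~ E′. For a permutation σ,
-- σ(ʲE) has unit σ(j)-th column and is associated to σE, so it equals ^{σ(j)}E
-- exactly when σE ~ E.
module Submission where

open import Defs hiding (sym)
open import Data.Nat using (ℕ; _+_)
open import Data.Fin using (Fin; zero; _≟_)
open import Data.Fin.Permutation using (Permutation′; _⟨$⟩ʳ_; _⟨$⟩ˡ_; inverseˡ)
open import Data.Product using (_×_; ∃; _,_)
open import Data.Sign using (Sign; _*_) renaming (+ to ⊕; - to ⊖)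
open import Data.Sign.Properties using (s*s≡+; *-identityʳ; *-assoc; *-commutativeSemigroup)
open import Algebra.Properties.CommutativeSemigroup *-commutativeSemigroup using (interchange)
open import Function.Bundles using (_⇔_; mk⇔)
open import Relation.Nullary using (yes; no; contradiction)
open import Relation.Binary.PropositionalEquality using (_≡_; refl; sym; cong; subst; module ≡-Reasoning)

open ≡-Reasoning

private
  variable
    n : ℕ
    E F G : SignMatrix n

UnitDiagonal : SignMatrix n → Set
UnitDiagonal E = ∀ i → E i i ≡ ⊕

UnitColumn : Fin n → SignMatrix n → Set
UnitColumn k E = ∀ a → E a k ≡ ⊕

*≡⊕⇒≡ : ∀ {s t : Sign} → s * t ≡ ⊕ → s ≡ t
*≡⊕⇒≡ {⊕} {⊕} _ = refl
*≡⊕⇒≡ {⊖} {⊖} _ = refl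

≋⇒Associated : E ≋ F → Associated E F
≋⇒Associated E≋F = (λ _ → ⊕) , λ i j → sym (E≋F i j)

Associated-sym : Associated E F → Associated F E
Associated-sym {E = E} {F = F} (ν , F≡) = ν , λ i j → let c = ν i * ν j in begin
  E i j              ≡⟨ cong (_* E i j) (sym (s*s≡+ c)) ⟩
  (c * c) * E i j    ≡⟨ *-assoc c c (E i j) ⟩
  c * (c * E i j)    ≡⟨ cong (c *_) (sym (F≡ i j)) ⟩
  c * F i j          ∎

Associated-trans : Associated E F → Associated F G → Associated E G
Associated-trans {E = E} {F = F} {G = G} (ν , F≡) (μ , G≡) = (λ i → μ i * ν i) , λ i j → begin
  G i j                              ≡⟨ G≡ i j ⟩
  (μ i * μ j) * F i j                ≡⟨ cong ((μ i * μ j) *_) (F≡ i j) ⟩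
  (μ i * μ j) * ((ν i * ν j) * E i j) ≡⟨ sym (*-assoc (μ i * μ j) (ν i * ν j) (E i j)) ⟩
  ((μ i * μ j) * (ν i * ν j)) * E i j ≡⟨ cong (_* E i j) (interchange (μ i) (μ j) (ν i) (ν j)) ⟩
  ((μ i * ν i) * (μ j * ν j)) * E i j ∎

Associated-unitDiagonal : Associated E F → UnitDiagonal E → UnitDiagonal F
Associated-unitDiagonal {E = E} {F = F} (ν , F≡) diagE i = begin
  F i i                  ≡⟨ F≡ i i ⟩
  (ν i * ν i) * E i i    ≡⟨ cong (_* E i i) (s*s≡+ (ν i)) ⟩
  E i i                  ≡⟨ diagE i ⟩
  ⊕                      ∎

Associated-unitColumn-unique : ∀ {k} → Associated F G → UnitColumn k F → UnitColumn k G → F ≋ G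
Associated-unitColumn-unique {F = F} {G = G} {k = k} (μ , G≡) colF colG i j = sym (begin
  G i j                  ≡⟨ G≡ i j ⟩
  (μ i * μ j) * F i j    ≡⟨ cong (λ s → (s * μ j) * F i j) (μ≡μk i) ⟩
  (μ k * μ j) * F i j    ≡⟨ cong (λ s → (μ k * s) * F i j) (μ≡μk j) ⟩
  (μ k * μ k) * F i j    ≡⟨ cong (_* F i j) (s*s≡+ (μ k)) ⟩
  F i j                  ∎)
  where
  μ≡μk : ∀ a → μ a ≡ μ k
  μ≡μk a = *≡⊕⇒≡ (begin
    μ a * μ k              ≡⟨ sym (*-identityʳ (μ a * μ k)) ⟩
    (μ a * μ k) * ⊕        ≡⟨ cong ((μ a * μ k) *_) (sym (colF a)) ⟩
    (μ a * μ k) * F a k    ≡⟨ sym (G≡ a k) ⟩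
    G a k                  ≡⟨ colG a ⟩
    ⊕                      ∎)

localize-associated : ∀ k → Associated E (localize k E)
localize-associated {E = E} k = locSign E k , λ _ _ → refl

locSign-column : UnitDiagonal E → ∀ k a → locSign E k a ≡ E a k
locSign-column diagE k a with a ≟ k
... | yes refl = sym (diagE a)
... | no _     = refl

localize-unitColumn : UnitDiagonal E → ∀ k → UnitColumn k (localize k E)
localize-unitColumn {E = E} diagE k a = begin
  (locSign E k a * locSign E k k) * E a k ≡⟨ cong (λ s → (locSign E k a * s) * E a k) (locSign-column diagE k k) ⟩
  (locSign E k a * E k k) * E a k         ≡⟨ cong (λ s → (locSign E k a * s) * E a k) (diagE k) ⟩
  (locSign E k a * ⊕) * E a k             ≡⟨ cong (_* E a k) (*-identityʳ (locSign E k a)) ⟩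
  locSign E k a * E a k                   ≡⟨ cong (_* E a k) (locSign-column diagE k a) ⟩
  E a k * E a k                           ≡⟨ s*s≡+ (E a k) ⟩
  ⊕                                       ∎

localize-respects-Associated : UnitDiagonal E → Associated E F → ∀ k → localize k E ≋ localize k F
localize-respects-Associated diagE E~F k =
  Associated-unitColumn-unique
    (Associated-trans (Associated-sym (localize-associated k)) (Associated-trans E~F (localize-associated k)))
    (localize-unitColumn diagE k)
    (localize-unitColumn (Associated-unitDiagonal E~F diagE) k)

localize-reflects-Associated : ∀ k → localize k E ≋ localize k F → Associated E F
localize-reflects-Associated k kE≋kF =
  Associated-trans (localize-associated k)
    (Associated-trans (≋⇒Associated kE≋kF) (Associated-sym (localize-associated k)))

permAct-Associated : ∀ σ → Associated E F → Associated (permAct σ E) (permAct σ F)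
permAct-Associated σ (ν , F≡) = (λ i → ν (σ ⟨$⟩ˡ i)) , λ i j → F≡ (σ ⟨$⟩ˡ i) (σ ⟨$⟩ˡ j)

permAct-unitColumn : ∀ σ {k} → UnitColumn k E → UnitColumn (σ ⟨$⟩ʳ k) (permAct σ E)
permAct-unitColumn {E = E} σ {k} colE a =
  subst (λ l → E (σ ⟨$⟩ˡ a) l ≡ ⊕) (sym (inverseˡ σ)) (colE (σ ⟨$⟩ˡ a))

permAct-localize-if-Associated : UnitDiagonal E → ∀ σ → Associated E (permAct σ E) →
  ∀ j → permAct σ (localize j E) ≋ localize (σ ⟨$⟩ʳ j) E
permAct-localize-if-Associated {E = E} diagE σ E~σE j =
  Associated-unitColumn-unique
    (Associated-trans (permAct-Associated σ (Associated-sym (localize-associated j)))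
      (Associated-trans (Associated-sym E~σE) (localize-associated (σ ⟨$⟩ʳ j))))
    (permAct-unitColumn {E = localize j E} σ (localize-unitColumn diagE j))
    (localize-unitColumn diagE (σ ⟨$⟩ʳ j))

Associated-if-permAct-localize : ∀ σ k → permAct σ (localize k E) ≋ localize (σ ⟨$⟩ʳ k) E →
  Associated E (permAct σ E)
Associated-if-permAct-localize σ k σkE≋σkE =
  Associated-trans (localize-associated (σ ⟨$⟩ʳ k))
    (Associated-trans (Associated-sym (≋⇒Associated σkE≋σkE))
      (permAct-Associated σ (Associated-sym (localize-associated k))))

graphMatrix-unitDiagonal : (Γ : SimpleGraph n) → UnitDiagonal (graphMatrix Γ)
graphMatrix-unitDiagonal Γ i with i ≟ i
... | yes _  = refl
... | no i≢i = contradiction refl i≢i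

proposition3 : (m : ℕ) → let n = 3 + m in (Γ Γ′ : SimpleGraph n) →
    (∀ (j k : Fin n) → localize k (graphMatrix Γ) ≋ localize k (localize j (graphMatrix Γ)))
    × ((Associated (graphMatrix Γ) (graphMatrix Γ′) ⇔ ∃ (λ (k : Fin n) → localize k (graphMatrix Γ) ≋ localize k (graphMatrix Γ′)))
      × (Associated (graphMatrix Γ) (graphMatrix Γ′) → ∀ (j : Fin n) → localize j (graphMatrix Γ) ≋ localize j (graphMatrix Γ′)))
    × (∀ (σ : Permutation′ n) →
        (Associated (graphMatrix Γ) (permAct σ (graphMatrix Γ)) ⇔ (∀ (j : Fin n) → permAct σ (localize j (graphMatrix Γ)) ≋ localize (σ ⟨$⟩ʳ j) (graphMatrix Γ)))
        × ((∀ (j : Fin n) → permAct σ (localize j (graphMatrix Γ)) ≋ localize (σ ⟨$⟩ʳ j) (graphMatrix Γ))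
          ⇔ ∃ (λ (k : Fin n) → permAct σ (localize k (graphMatrix Γ)) ≋ localize (σ ⟨$⟩ʳ k) (graphMatrix Γ))))
proposition3 m Γ Γ′ =
  (λ j k → localize-respects-Associated diag (localize-associated j) k)
  , ( mk⇔ (λ E~E′ → zero , localize-respects-Associated diag E~E′ zero)
          (λ (k , kE≋kE′) → localize-reflects-Associated k kE≋kE′)
    , localize-respects-Associated diag)
  , λ σ →
      mk⇔ (permAct-localize-if-Associated diag σ)
          (λ all-j → Associated-if-permAct-localize σ zero (all-j zero))
    , mk⇔ (λ all-j → zero , all-j zero)
          (λ (k , σkE≋σkE) → permAct-localize-if-Associated diag σ (Associated-if-permAct-localize σ k σkE≋σkE))
  where
  diag : UnitDiagonal (graphMatrix Γ)
  diag = graphMatrix-unitDiagonal Γ
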